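{- Let $\mathbf{A}$ be any (possibly empty) composition of operators from $\{\mathbf{S},\mathbf{R}\}$. For every permutation $\theta$ sorted by $\mathbf{S}\circ\mathbf{A}$, the permutations $\theta$ and $\Phi_{\mathbf{A}}(\theta)$ have - the same number and positions of right-to-left maxima, - the same number and positions of left-to-right maxima, and - the same up-down word, and hence agree on every permutation statistic determined by the up-down word.
   Context: Notation and conventions. - Permutations are in one-line notation, with composition $(\lambda\circ\sigma)(i)=\lambda(\sigma(i))$. - A sequence of distinct integers is identified with the permutation order-isomorphic to it. - $\mathrm{Av}(231)$ (resp. $\mathrm{Av}(132)$) is the set of permutations avoiding $231$ (resp. $132$). Operators. - $\mathbf{S}(\varepsilon)=\varepsilon$ and $\mathbf{S}(\alpha n\beta)=\mathbf{S}(\alpha)\mathbf{S}(\beta)n$, where $n$ is the maximum entry. - $\mathbf{R}$ is reversal. - $\theta$ is sorted by $\mathbf{S}\circ\mathbf{A}$ if $\mathbf{S}(\mathbf{A}(\theta))$ is the identity, equivalently $\mathbf{A}(\theta)\in\mathrm{Av}(231)$. The bijection $P$ and the map $\Phi_{\mathbf{A}}$. - $\alpha\oplus\beta=\alpha(\beta+|\alpha|)$ and $\alpha\ominus\beta=(\alpha+|\beta|)\beta$. - $P:\mathrm{Av}(231)\to\mathrm{Av}(132)$ is defined by $P(\varepsilon)=\varepsilon$ and $P(\alpha\oplus(1\ominus\beta))=(P(\alpha)\oplus1)\ominus P(\beta)$, using the unique decomposition of nonempty $231$-avoiders as $\alpha\oplus(1\ominus\beta)$ with $\alpha,\beta\in\mathrm{Av}(231)$.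 - $\lambda_\pi$ is defined by $P(\pi)=\lambda_\pi\circ\pi$. - $\Phi_{\mathbf{A}}(\theta)=\lambda_{\mathbf{A}(\theta)}\circ\theta$. Statistics. - A left-to-right (resp. right-to-left) maximum of $\pi$ is an entry $\pi(i)$ larger than all $\pi(j)$ with $j<i$ (resp. $j>i$). - The up-down word of $\pi$ of size $n$ is $w\in\{u,d\}^{n-1}$ with $w(i)=u$ iff $\pi(i)<\pi(i+1)$. -}

module Defs where

open import Data.Nat using (ℕ; zero; suc; _+_; _⊔_; _<_; _<ᵇ_; _≟_)
open import Data.Bool using (Bool; true; false; if_then_else_)
open import Data.List using (List; []; _∷_; _++_; [_]; map; length; reverse; foldr;
  filter; upTo; drop; take)
open import Data.List.Relation.Binary.Permutation.Propositional using (_↭_)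
open import Data.Maybe using (Maybe; just; nothing)
open import Data.Product using (_×_; _,_; ∃; Σ-syntax)
open import Data.Nat using (_<?_)
open import Relation.Nullary using (¬_; does)
open import Relation.Binary.PropositionalEquality using (_≡_)

-- Permutations in one-line notation as lists of ℕ (entries 1..n).

idPerm : ℕ → List ℕ
idPerm n = map suc (upTo n)

IsPerm : List ℕ → Set
IsPerm π = π ↭ idPerm (length π)

-- entry at 0-based position i (default 0 outside the range)
at : List ℕ → ℕ → ℕ
at []       _       = 0
at (x ∷ xs) zero    = x
at (x ∷ xs) (suc i) = at xs i

posOf : ℕ → List ℕ → ℕ
posOf v []       = 0
posOf v (x ∷ xs) = if does (v ≟ x) then 0 else suc (posOf v xs)

maxL : List ℕ → ℕ
maxL = foldr _⊔_ 0

breakAt : ℕ → List ℕ → List ℕ × List ℕ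
breakAt m []       = [] , []
breakAt m (x ∷ xs) with does (x ≟ m)
... | true  = [] , xs
... | false with breakAt m xs
...   | (a , b) = (x ∷ a) , b

splitMax : List ℕ → Maybe (List ℕ × ℕ × List ℕ)
splitMax []       = nothing
splitMax (x ∷ xs) with breakAt (maxL (x ∷ xs)) (x ∷ xs)
... | (a , b) = just (a , maxL (x ∷ xs) , b)

-- Stack sort S(ε)=ε, S(α n β) = S(α) S(β) n  (fuel = length suffices)

S' : ℕ → List ℕ → List ℕ
S' zero    _  = []
S' (suc k) xs with splitMax xs
... | nothing          = []
... | just (a , n , b) = S' k a ++ S' k b ++ [ n ]

S : List ℕ → List ℕ
S xs = S' (length xs) xs

R : List ℕ → List ℕ
R = reverse

data Op : Set where
  opS opR : Op

applyOp : Op → List ℕ → List ℕ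
applyOp opS = S
applyOp opR = R

-- A composition of operators: [o₁, …, oₖ] denotes o₁ ∘ … ∘ oₖ ([] = identity)
applyOps : List Op → List ℕ → List ℕ
applyOps []       π = π
applyOps (o ∷ os) π = applyOp o (applyOps os π)

Contains231 : List ℕ → Set
Contains231 π = ∃ λ i → ∃ λ j → ∃ λ k →
  (i < j) × (j < k) × (k < length π) × (at π k < at π i) × (at π i < at π j)

Av231 : List ℕ → Set
Av231 π = ¬ Contains231 π

SortedBy : List Op → List ℕ → Set
SortedBy A θ = S (applyOps A θ) ≡ idPerm (length (applyOps A θ))

-- The bijection P : Av(231) → Av(132).
-- A nonempty 231-avoider α ⊕ (1 ⊖ β) is, as a sequence, α n β (n = max),
-- and P(α ⊕ (1 ⊖ β)) = (P(α) ⊕ 1) ⊖ P(β) is the sequence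
-- (P(α) + |β|) n P(β).

rank : List ℕ → ℕ → ℕ
rank xs x = suc (length (filter (λ y → y <? x) xs))

standardize : List ℕ → List ℕ
standardize xs = map (rank xs) xs

P' : ℕ → List ℕ → List ℕ
P' zero    _  = []
P' (suc k) xs with splitMax xs
... | nothing          = []
... | just (a , n , b) =
  map (λ v → v + length b) (P' k (standardize a)) ++ [ length xs ] ++ P' k (standardize b)

P : List ℕ → List ℕ
P π = P' (length π) π

-- λ_π defined by P(π) = λ_π ∘ π, i.e. λ_π(π(i)) = P(π)(i)
lam : List ℕ → ℕ → ℕ
lam π v = at (P π) (posOf v π)

Φ : List Op → List ℕ → List ℕ
Φ A θ = map (lam (applyOps A θ)) θ

-- Statistics (positions are 1-based)

allB : (ℕ → Bool) → List ℕ → Bool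
allB p []       = true
allB p (x ∷ xs) = if p x then allB p xs else false

positions : List ℕ → List ℕ
positions π = map suc (upTo (length π))

isRLMax : List ℕ → ℕ → Bool
isRLMax π i = allB (λ y → y <ᵇ at π (i Data.Nat.∸ 1)) (drop i π)

isLRMax : List ℕ → ℕ → Bool
isLRMax π i = allB (λ y → y <ᵇ at π (i Data.Nat.∸ 1)) (take (i Data.Nat.∸ 1) π)

rlMaxPositions : List ℕ → List ℕ
rlMaxPositions π = filter (λ i → isRLMax π i Data.Bool.≟ true) (positions π)

lrMaxPositions : List ℕ → List ℕ
lrMaxPositions π = filter (λ i → isLRMax π i Data.Bool.≟ true) (positions π)

data UD : Set where
  u d : UD

upDown : List ℕ → List UD
upDown (x ∷ y ∷ r) = (if x <ᵇ y then u else d) ∷ upDown (y ∷ r)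
upDown _           = []

-- Call two entries x, y of a sequence unseparated if every entry between them is at most
-- max(x, y). Reversal maps unseparated pairs to unseparated pairs, and so does stack sorting:
-- in S(α n β) = S(α) S(β) n a pair inside α or inside β is handled by induction, and any other
-- pair ends up separated only by entries of α and β, which are below n. The bijection P acts on a
-- sequence π of distinct entries as a relabelling that keeps the relative order of every
-- unseparated pair of π (again by induction along π = α n β). Hence λ_{A(θ)} keeps the relative
-- order of every unseparated pair of θ. Adjacent entries are unseparated, and so is an entry
-- together with a later one when everything in between is smaller; the up-down word and the
-- left-to-right and right-to-left maxima depend on nothing else.

module Submission where

open import Defs
open import Data.Bool using (Bool; true; false; if_then_else_)
import Data.Bool as Bool
open import Data.List
  using (List; []; _∷_; _++_; [_]; map; length; reverse; filter; upTo; take; drop)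
import Data.List.Properties as List
open import Data.List.Membership.Propositional using (_∈_; _∉_)
open import Data.List.Membership.Propositional.Properties
  using (∈-∃++; ∈-++⁺ˡ; ∈-++⁺ʳ; ∈-++⁻; ∈-map⁺)
open import Data.List.Relation.Binary.Permutation.Propositional
  using (_↭_; ↭-refl; ↭-sym; ↭-trans; ↭⇒↭ₛ)
open import Data.List.Relation.Binary.Permutation.Propositional.Properties
  using (All-resp-↭; ∈-resp-↭; ↭-reverse; ++⁺; ++⁺ˡ; ++-comm)
import Data.List.Relation.Binary.Permutation.Setoid.Properties as PermutationSetoid
open import Data.List.Relation.Binary.Sublist.Propositional using (⊆-refl)
open import Data.List.Relation.Binary.Sublist.Propositional.Properties
  using (filter⁺; length-mono-≤)
open import Data.List.Relation.Unary.All as All using (All; []; _∷_)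
import Data.List.Relation.Unary.All.Properties as All
open import Data.List.Relation.Unary.Any using (here; there)
open import Data.List.Relation.Unary.AllPairs using ([]; _∷_)
open import Data.List.Relation.Unary.Unique.Propositional using (Unique)
import Data.List.Relation.Unary.Unique.Propositional.Properties as Unique
open import Data.Nat
open import Data.Nat.Properties
open import Data.List.Membership.DecPropositional _≟_ using (_∈?_)
open import Data.Product using (_×_; _,_; proj₁; proj₂)
open import Data.Sum using (_⊎_; inj₁; inj₂; swap)
open import Function using (_∘_; _⇔_; mk⇔; Equivalence)
open import Relation.Binary.Core using (_Preserves_⟶_)
open import Relation.Binary.Definitions using (tri<; tri≈; tri>)
open import Relation.Binary.PropositionalEquality hiding ([_])
open import Relation.Nullary using (¬_; yes; no; does; proof; contradiction)
open import Relation.Nullary.Reflects using (ofʸ; ofⁿ)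

private
  variable
    x y x′ y′ x″ y″ : ℕ
    xs θ π : List ℕ

SameOrder : ℕ → ℕ → ℕ → ℕ → Set
SameOrder x y x′ y′ = (x < y → x′ < y′) × (y < x → y′ < x′)

SameOrder-sym : SameOrder x y x′ y′ → SameOrder y x y′ x′
SameOrder-sym (x<y⇒ , y<x⇒) = y<x⇒ , x<y⇒

SameOrder-trans : SameOrder x y x′ y′ → SameOrder x′ y′ x″ y″ → SameOrder x y x″ y″
SameOrder-trans (p , q) (p′ , q′) = p′ ∘ p , q′ ∘ q

SameOrder-≤ : x ≤ y → x′ < y′ → SameOrder x y x′ y′
SameOrder-≤ x≤y x′<y′ = (λ _ → x′<y′) , (λ y<x → contradiction x≤y (<⇒≱ y<x))

SameOrder-+ʳ : ∀ c → SameOrder x y (x + c) (y + c)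
SameOrder-+ʳ c = +-monoˡ-< c , +-monoˡ-< c

SameOrder⇒⇔ : ∀ (f : ℕ → ℕ) → SameOrder x y (f x) (f y) → (x < y ⇔ f x < f y)
SameOrder⇒⇔ {x} {y} f (x<y⇒ , y<x⇒) = mk⇔ x<y⇒ reflect
  where
  reflect : f x < f y → x < y
  reflect fx<fy with <-cmp x y
  ... | tri< x<y _ _  = x<y
  ... | tri≈ _ refl _ = contradiction fx<fy (<-irrefl refl)
  ... | tri> _ _ y<x  = contradiction fx<fy (<-asym (y<x⇒ y<x))

<ᵇ-cong : (x < y ⇔ x′ < y′) → (x <ᵇ y) ≡ (x′ <ᵇ y′)
<ᵇ-cong {x} {y} {x′} {y′} x<y⇔ with x <ᵇ y | <ᵇ-reflects-< x y | x′ <ᵇ y′ | <ᵇ-reflects-< x′ y′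
... | true  | _       | true  | _       = refl
... | false | _       | false | _       = refl
... | true  | ofʸ x<y | false | ofⁿ x′≮y′ = contradiction (Equivalence.to x<y⇔ x<y) x′≮y′
... | false | ofⁿ x≮y | true  | ofʸ x′<y′ = contradiction (Equivalence.from x<y⇔ x′<y′) x≮y

<ᵇ-irrefl : ∀ x → (x <ᵇ x) ≡ false
<ᵇ-irrefl x with x <ᵇ x | <ᵇ-reflects-< x x
... | false | _       = refl
... | true  | ofʸ x<x = contradiction x<x (<-irrefl refl)

-- Unseparated pairs

data Unseparated (xs : List ℕ) (x y : ℕ) : Set where
  unseparated : ∀ p m q → xs ≡ p ++ x ∷ m ++ y ∷ q → All (_≤ x ⊔ y) m → Unseparated xs x y

UnseparatedPair : List ℕ → ℕ → ℕ → Set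
UnseparatedPair xs x y = Unseparated xs x y ⊎ Unseparated xs y x

UnseparatedMonotone : (ℕ → ℕ) → List ℕ → Set
UnseparatedMonotone f xs = ∀ {x y} → Unseparated xs x y → SameOrder x y (f x) (f y)

Unseparated-[] : ¬ Unseparated [] x y
Unseparated-[] (unseparated [] _ _ () _)
Unseparated-[] (unseparated (_ ∷ _) _ _ () _)

Unseparated-∈ˡ : Unseparated xs x y → x ∈ xs
Unseparated-∈ˡ (unseparated p m q refl _) = ∈-++⁺ʳ p (here refl)

Unseparated-∈ʳ : Unseparated xs x y → y ∈ xs
Unseparated-∈ʳ (unseparated p m q refl _) = ∈-++⁺ʳ p (there (∈-++⁺ʳ m (here refl)))

UnseparatedMonotone-cong : ∀ {f g} → (∀ {x} → x ∈ xs → f x ≡ g x) →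
  UnseparatedMonotone g xs → UnseparatedMonotone f xs
UnseparatedMonotone-cong f≡g mono w =
  subst₂ (SameOrder _ _) (sym (f≡g (Unseparated-∈ˡ w))) (sym (f≡g (Unseparated-∈ʳ w))) (mono w)

Unseparated-++ˡ : ∀ l → Unseparated xs x y → Unseparated (l ++ xs) x y
Unseparated-++ˡ {x = x} {y} l (unseparated p m q refl m≤) =
  unseparated (l ++ p) m q (sym (List.++-assoc l p (x ∷ m ++ y ∷ q))) m≤

Unseparated-++ʳ : ∀ r → Unseparated xs x y → Unseparated (xs ++ r) x y
Unseparated-++ʳ {x = x} {y} r (unseparated p m q refl m≤) = unseparated p m (q ++ r) eq m≤
  where
  eq : (p ++ x ∷ m ++ y ∷ q) ++ r ≡ p ++ x ∷ m ++ y ∷ q ++ r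
  eq = trans (List.++-assoc p (x ∷ m ++ y ∷ q) r)
             (cong (λ t → p ++ x ∷ t) (List.++-assoc m (y ∷ q) r))

Unseparated-∈-++ : ∀ {u v} → x ∈ u → y ∈ v → All (_≤ x ⊔ y) u → All (_≤ x ⊔ y) v →
  Unseparated (u ++ v) x y
Unseparated-∈-++ {x} {y} x∈u y∈v u≤ v≤ with ∈-∃++ x∈u | ∈-∃++ y∈v
... | u₁ , u₂ , refl | v₁ , v₂ , refl =
  unseparated u₁ (u₂ ++ v₁) v₂ eq (All.++⁺ (All.tail (All.++⁻ʳ u₁ u≤)) (All.++⁻ˡ v₁ v≤))
  where
  eq : (u₁ ++ [ x ] ++ u₂) ++ v₁ ++ [ y ] ++ v₂ ≡ u₁ ++ x ∷ (u₂ ++ v₁) ++ y ∷ v₂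
  eq = trans (List.++-assoc u₁ (x ∷ u₂) _) (cong (λ t → u₁ ++ x ∷ t) (sym (List.++-assoc u₂ v₁ _)))

Unseparated-reverse : Unseparated xs x y → Unseparated (reverse xs) y x
Unseparated-reverse {x = x} {y} (unseparated p m q refl m≤) =
  unseparated (reverse q) (reverse m) (reverse p) eq
    (All.map (λ {z} z≤ → subst (z ≤_) (⊔-comm x y) z≤) (All-resp-↭ (↭-sym (↭-reverse m)) m≤))
  where
  reverse-mid : ∀ (l : List ℕ) z r → reverse (l ++ z ∷ r) ≡ reverse r ++ z ∷ reverse l
  reverse-mid l z r = begin
    reverse (l ++ z ∷ r)              ≡⟨ List.reverse-++ l (z ∷ r) ⟩
    reverse (z ∷ r) ++ reverse l      ≡⟨ cong (_++ reverse l) (List.unfold-reverse z r) ⟩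
    (reverse r ++ [ z ]) ++ reverse l ≡⟨ List.++-assoc (reverse r) [ z ] (reverse l) ⟩
    reverse r ++ z ∷ reverse l        ∎
    where open ≡-Reasoning
  eq : reverse (p ++ x ∷ m ++ y ∷ q) ≡ reverse q ++ y ∷ reverse m ++ x ∷ reverse p
  eq = begin
    reverse (p ++ x ∷ m ++ y ∷ q)                  ≡⟨ reverse-mid p x (m ++ y ∷ q) ⟩
    reverse (m ++ y ∷ q) ++ x ∷ reverse p          ≡⟨ cong (_++ x ∷ reverse p) (reverse-mid m y q) ⟩
    (reverse q ++ y ∷ reverse m) ++ x ∷ reverse p  ≡⟨ List.++-assoc (reverse q) (y ∷ reverse m) _ ⟩
    reverse q ++ y ∷ reverse m ++ x ∷ reverse p    ∎
    where open ≡-Reasoning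

Unseparated-map : ∀ {f} → f Preserves _≤_ ⟶ _≤_ → Unseparated xs x y →
  Unseparated (map f xs) (f x) (f y)
Unseparated-map {x = x} {y} {f} f-mono (unseparated p m q refl m≤) =
  unseparated (map f p) (map f m) (map f q) eq
    (All.map⁺ (All.map (λ {z} z≤ → subst (f z ≤_) (mono-≤-distrib-⊔ f-mono x y) (f-mono z≤)) m≤))
  where
  eq : map f (p ++ x ∷ m ++ y ∷ q) ≡ map f p ++ f x ∷ map f m ++ f y ∷ map f q
  eq = trans (List.map-++ f p _) (cong (λ t → map f p ++ f x ∷ t) (List.map-++ f m _))

Unseparated-insert : ∀ {z r} → z ≤ x → Unseparated (x ∷ r) y y′ → Unseparated (x ∷ z ∷ r) y y′
Unseparated-insert z≤x (unseparated [] m q refl m≤) =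
  unseparated [] (_ ∷ m) q refl (≤-trans z≤x (m≤m⊔n _ _) ∷ m≤)
Unseparated-insert {x} {z = z} z≤x (unseparated (_ ∷ p) m q refl m≤) =
  unseparated (x ∷ z ∷ p) m q refl m≤

UnseparatedMonotone-transfer : ∀ {f} → UnseparatedMonotone f π →
  (∀ {x y} → Unseparated θ x y → UnseparatedPair π x y) → UnseparatedMonotone f θ
UnseparatedMonotone-transfer mono θ⇒π w with θ⇒π w
... | inj₁ w′ = mono w′
... | inj₂ w′ = SameOrder-sym (mono w′)

UnseparatedPair-++ˡ : ∀ l → UnseparatedPair xs x y → UnseparatedPair (l ++ xs) x y
UnseparatedPair-++ˡ l (inj₁ w) = inj₁ (Unseparated-++ˡ l w)
UnseparatedPair-++ˡ l (inj₂ w) = inj₂ (Unseparated-++ˡ l w)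

UnseparatedPair-++ʳ : ∀ r → UnseparatedPair xs x y → UnseparatedPair (xs ++ r) x y
UnseparatedPair-++ʳ r (inj₁ w) = inj₁ (Unseparated-++ʳ r w)
UnseparatedPair-++ʳ r (inj₂ w) = inj₂ (Unseparated-++ʳ r w)

UnseparatedPair-reverse : UnseparatedPair xs x y → UnseparatedPair (reverse xs) x y
UnseparatedPair-reverse (inj₁ w) = inj₂ (Unseparated-reverse w)
UnseparatedPair-reverse (inj₂ w) = inj₁ (Unseparated-reverse w)

data Locate (a : List ℕ) (n : ℕ) (b p : List ℕ) (x : ℕ) (r : List ℕ) : Set where
  left   : ∀ c → a ≡ p ++ x ∷ c → r ≡ c ++ n ∷ b → Locate a n b p x r
  middle : a ≡ p → x ≡ n → r ≡ b → Locate a n b p x r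
  right  : ∀ c → p ≡ a ++ n ∷ c → b ≡ c ++ x ∷ r → Locate a n b p x r

locate : ∀ a n b p x r → a ++ n ∷ b ≡ p ++ x ∷ r → Locate a n b p x r
locate []      n b []      x r refl = middle refl refl refl
locate []      n b (_ ∷ p) x r refl = right p refl refl
locate (_ ∷ a) n b []      x r refl = left a refl refl
locate (z ∷ a) n b (_ ∷ p) x r eq with List.∷-injective eq
... | refl , eq′ with locate a n b p x r eq′
...   | left c a≡ r≡     = left c (cong (z ∷_) a≡) r≡
...   | middle a≡ x≡ r≡  = middle (cong (z ∷_) a≡) x≡ r≡
...   | right c p≡ b≡    = right c (cong (z ∷_) p≡) b≡

data UnseparatedAround (a : List ℕ) (n : ℕ) (b : List ℕ) (x y : ℕ) : Set where
  within-left  : Unseparated a x y → UnseparatedAround a n b x y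
  left-to-n    : x ∈ a → y ≡ n → UnseparatedAround a n b x y
  across-n     : x ∈ a → y ∈ b → n ≤ x ⊔ y → UnseparatedAround a n b x y
  n-to-right   : x ≡ n → y ∈ b → UnseparatedAround a n b x y
  within-right : Unseparated b x y → UnseparatedAround a n b x y

unseparatedAround : ∀ {a n b x y} → Unseparated (a ++ n ∷ b) x y → UnseparatedAround a n b x y
unseparatedAround {a} {n} {b} {x} {y} (unseparated p m q eq m≤)
  with locate a n b p x (m ++ y ∷ q) eq
... | middle _ x≡n refl = n-to-right x≡n (∈-++⁺ʳ m (here refl))
... | right c _ refl    = within-right (unseparated c m q refl m≤)
... | left c refl r≡ with locate c n b m y q (sym r≡)
...   | left c′ refl _    = within-left (unseparated p m c′ refl m≤)
...   | middle refl y≡n _ = left-to-n (∈-++⁺ʳ p (here refl)) y≡n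
...   | right c′ refl refl =
          across-n (∈-++⁺ʳ p (here refl)) (∈-++⁺ʳ c′ (here refl))
                   (All.lookup m≤ (∈-++⁺ʳ c (here refl)))

-- does (x ≟ m) in Defs computes to x ≡ᵇ m, so that boolean is abstracted with its reflection.
breakAt-++ : ∀ {m} xs → m ∈ xs → xs ≡ proj₁ (breakAt m xs) ++ m ∷ proj₂ (breakAt m xs)
breakAt-++ {m} (x ∷ xs) m∈ with x ≡ᵇ m | proof (x ≟ m)
... | _ | ofʸ refl = refl
... | _ | ofⁿ x≢m with m∈
...   | here m≡x   = contradiction (sym m≡x) x≢m
...   | there m∈xs = cong (x ∷_) (breakAt-++ xs m∈xs)

maxL-bound : ∀ xs → All (_≤ maxL xs) xs
maxL-bound []       = []
maxL-bound (x ∷ xs) = m≤m⊔n x (maxL xs) ∷ All.map (m≤n⇒m≤o⊔n x) (maxL-bound xs)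

maxL-∈ : ∀ x xs → maxL (x ∷ xs) ∈ x ∷ xs
maxL-∈ x []       = here (⊔-identityʳ x)
maxL-∈ x (y ∷ ys) with ⊔-sel x (maxL (y ∷ ys))
... | inj₁ eq = here eq
... | inj₂ eq = there (subst (_∈ y ∷ ys) (sym eq) (maxL-∈ y ys))

-- α n β exactly as splitMax computes it, so that S' and P' on z ∷ zs unfold to terms in a, n, b.
module MaxSplit (z : ℕ) (zs : List ℕ) where

  n : ℕ
  n = maxL (z ∷ zs)

  a b : List ℕ
  a = proj₁ (breakAt n (z ∷ zs))
  b = proj₂ (breakAt n (z ∷ zs))

  split : z ∷ zs ≡ a ++ n ∷ b
  split = breakAt-++ (z ∷ zs) (maxL-∈ z zs)

  bounded : All (_≤ n) (a ++ n ∷ b)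
  bounded = subst (All (_≤ n)) split (maxL-bound (z ∷ zs))

  module _ {k} (len≤ : length (z ∷ zs) ≤ suc k) where

    length-a+b≤ : length a + length b ≤ k
    length-a+b≤ = ≤-pred (subst (_≤ suc k) length≡ len≤)
      where
      length≡ : length (z ∷ zs) ≡ suc (length a + length b)
      length≡ = trans (cong length split) (trans (List.length-++ a) (+-suc (length a) (length b)))

    length-a≤ : length a ≤ k
    length-a≤ = ≤-trans (m≤m+n _ _) length-a+b≤

    length-b≤ : length b ≤ k
    length-b≤ = ≤-trans (m≤n+m _ _) length-a+b≤

-- Stack sorting

S'-↭ : ∀ k xs → length xs ≤ k → S' k xs ↭ xs
S'-↭ zero    []       _    = ↭-refl
S'-↭ (suc k) []       _    = ↭-refl
S'-↭ (suc k) (z ∷ zs) len≤ = ↭-trans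
  (++⁺ (S'-↭ k a (length-a≤ len≤)) (++⁺ (S'-↭ k b (length-b≤ len≤)) ↭-refl))
  (subst (a ++ b ++ [ n ] ↭_) (sym split) (++⁺ˡ a (++-comm b [ n ])))
  where open MaxSplit z zs

S-↭ : ∀ xs → S xs ↭ xs
S-↭ xs = S'-↭ (length xs) xs ≤-refl

module _ {a n b sa sb} (sa↭ : sa ↭ a) (sb↭ : sb ↭ b) (≤n : All (_≤ n) (a ++ n ∷ b)) where

  private
    sa≤ : All (_≤ n) sa
    sa≤ = All-resp-↭ (↭-sym sa↭) (All.++⁻ˡ a ≤n)

    sb≤ : All (_≤ n) sb
    sb≤ = All-resp-↭ (↭-sym sb↭) (All.tail (All.++⁻ʳ a ≤n))

    sbn≤ : All (_≤ n) (sb ++ [ n ])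
    sbn≤ = All.++⁺ sb≤ (≤-refl ∷ [])

    weaken : ∀ {c l} → n ≤ c → All (_≤ n) l → All (_≤ c) l
    weaken n≤c = All.map (λ z≤n → ≤-trans z≤n n≤c)

  S-step-unseparated :
    (∀ {x y} → Unseparated a x y → UnseparatedPair sa x y) →
    (∀ {x y} → Unseparated b x y → UnseparatedPair sb x y) →
    Unseparated (a ++ n ∷ b) x y → UnseparatedPair (sa ++ sb ++ [ n ]) x y
  S-step-unseparated sa-pres sb-pres uxy with unseparatedAround uxy
  ... | within-left w  = UnseparatedPair-++ʳ (sb ++ [ n ]) (sa-pres w)
  ... | within-right w = UnseparatedPair-++ˡ sa (UnseparatedPair-++ʳ [ n ] (sb-pres w))
  ... | left-to-n x∈a refl =
    inj₁ (Unseparated-∈-++ (∈-resp-↭ (↭-sym sa↭) x∈a) (∈-++⁺ʳ sb (here refl))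
           (weaken (m≤n⊔m _ n) sa≤) (weaken (m≤n⊔m _ n) sbn≤))
  ... | across-n x∈a y∈b n≤ =
    inj₁ (Unseparated-∈-++ (∈-resp-↭ (↭-sym sa↭) x∈a) (∈-++⁺ˡ (∈-resp-↭ (↭-sym sb↭) y∈b))
           (weaken n≤ sa≤) (weaken n≤ sbn≤))
  ... | n-to-right refl y∈b =
    inj₂ (Unseparated-++ˡ sa (Unseparated-∈-++ (∈-resp-↭ (↭-sym sb↭) y∈b) (here refl)
           (weaken (m≤n⊔m _ n) sb≤) (weaken (m≤n⊔m _ n) (≤-refl ∷ []))))

S'-unseparated : ∀ k xs → length xs ≤ k → Unseparated xs x y → UnseparatedPair (S' k xs) x y
S'-unseparated zero    []       _    uxy = contradiction uxy Unseparated-[]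
S'-unseparated (suc k) []       _    uxy = contradiction uxy Unseparated-[]
S'-unseparated (suc k) (z ∷ zs) len≤ uxy =
  S-step-unseparated (S'-↭ k a (length-a≤ len≤)) (S'-↭ k b (length-b≤ len≤)) bounded
    (S'-unseparated k a (length-a≤ len≤)) (S'-unseparated k b (length-b≤ len≤))
    (subst (λ l → Unseparated l _ _) split uxy)
  where open MaxSplit z zs

S-unseparated : UnseparatedPair xs x y → UnseparatedPair (S xs) x y
S-unseparated {xs} (inj₁ w) = S'-unseparated (length xs) xs ≤-refl w
S-unseparated {xs} (inj₂ w) = swap (S'-unseparated (length xs) xs ≤-refl w)

applyOps-↭ : ∀ A θ → applyOps A θ ↭ θ
applyOps-↭ []        θ = ↭-refl
applyOps-↭ (opS ∷ A) θ = ↭-trans (S-↭ (applyOps A θ)) (applyOps-↭ A θ)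
applyOps-↭ (opR ∷ A) θ = ↭-trans (↭-reverse (applyOps A θ)) (applyOps-↭ A θ)

applyOps-unseparated : ∀ A → UnseparatedPair θ x y → UnseparatedPair (applyOps A θ) x y
applyOps-unseparated []        w = w
applyOps-unseparated (opS ∷ A) w = S-unseparated (applyOps-unseparated A w)
applyOps-unseparated (opR ∷ A) w = UnseparatedPair-reverse (applyOps-unseparated A w)

Unique-↭ : ∀ {xs ys : List ℕ} → xs ↭ ys → Unique xs → Unique ys
Unique-↭ xs↭ys = PermutationSetoid.Unique-resp-↭ (setoid ℕ) (↭⇒↭ₛ xs↭ys)

Unique-idPerm : ∀ n → Unique (idPerm n)
Unique-idPerm n = Unique.map⁺ suc-injective (Unique.upTo⁺ n)

Unique-++⁻ˡ : ∀ (xs : List ℕ) {ys} → Unique (xs ++ ys) → Unique xs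
Unique-++⁻ˡ []       _          = []
Unique-++⁻ˡ (x ∷ xs) (x∉ ∷ uniq) = All.++⁻ˡ xs x∉ ∷ Unique-++⁻ˡ xs uniq

Unique-++⁻ʳ : ∀ (xs : List ℕ) {ys} → Unique (xs ++ ys) → Unique ys
Unique-++⁻ʳ []       uniq       = uniq
Unique-++⁻ʳ (x ∷ xs) (_ ∷ uniq) = Unique-++⁻ʳ xs uniq

Unique-++-disjoint : ∀ (xs : List ℕ) {ys x} → Unique (xs ++ ys) → x ∈ xs → x ∉ ys
Unique-++-disjoint (x ∷ xs) (x∉ ∷ _)   (here refl) x∈ys = All.lookup (All.++⁻ʳ xs x∉) x∈ys refl
Unique-++-disjoint (_ ∷ xs) (_ ∷ uniq) (there x∈)  = Unique-++-disjoint xs uniq x∈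

Unique-map⁺-local : ∀ {f : ℕ → ℕ} {xs} → (∀ {x y} → x ∈ xs → y ∈ xs → f x ≡ f y → x ≡ y) →
  Unique xs → Unique (map f xs)
Unique-map⁺-local {xs = []}     inj []          = []
Unique-map⁺-local {xs = x ∷ xs} inj (x∉ ∷ uniq) =
  All.map⁺ (All.tabulate (λ y∈ fx≡fy → All.lookup x∉ y∈ (inj (here refl) (there y∈) fx≡fy)))
  ∷ Unique-map⁺-local (λ x∈ y∈ → inj (there x∈) (there y∈)) uniq

rank-mono : ∀ xs → rank xs Preserves _≤_ ⟶ _≤_
rank-mono xs {x} {y} x≤y =
  s≤s (length-mono-≤
    (filter⁺ (_<? x) (_<? y) (λ { refl z<x → <-≤-trans z<x x≤y }) (⊆-refl {x = xs})))

rank-accept : ∀ {z} xs → z < x → rank (z ∷ xs) x ≡ suc (rank xs x)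
rank-accept {x} xs z<x = cong (suc ∘ length) (List.filter-accept (_<? x) z<x)

rank-reject : ∀ {z} xs → ¬ z < x → rank (z ∷ xs) x ≡ rank xs x
rank-reject {x} xs z≮x = cong (suc ∘ length) (List.filter-reject (_<? x) z≮x)

rank-strict : ∀ xs → x ∈ xs → x < y → rank xs x < rank xs y
rank-strict {x} {y} (x ∷ xs) (here refl) x<y = begin-strict
  rank (x ∷ xs) x  ≡⟨ rank-reject xs (<-irrefl refl) ⟩
  rank xs x        ≤⟨ rank-mono xs (<⇒≤ x<y) ⟩
  rank xs y        <⟨ n<1+n _ ⟩
  suc (rank xs y)  ≡⟨ rank-accept xs x<y ⟨
  rank (x ∷ xs) y  ∎
  where open ≤-Reasoning
rank-strict {x} {y} (z ∷ xs) (there x∈) x<y with z <? x | z <? y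
... | yes z<x | yes z<y = subst₂ _<_ (sym (rank-accept xs z<x)) (sym (rank-accept xs z<y))
                            (s≤s (rank-strict xs x∈ x<y))
... | yes z<x | no z≮y  = contradiction (<-trans z<x x<y) z≮y
... | no z≮x  | yes z<y = subst₂ _<_ (sym (rank-reject xs z≮x)) (sym (rank-accept xs z<y))
                            (m<n⇒m<1+n (rank-strict xs x∈ x<y))
... | no z≮x  | no z≮y  = subst₂ _<_ (sym (rank-reject xs z≮x)) (sym (rank-reject xs z≮y))
                            (rank-strict xs x∈ x<y)

rank-SameOrder : ∀ xs → x ∈ xs → y ∈ xs → SameOrder x y (rank xs x) (rank xs y)
rank-SameOrder xs x∈ y∈ = rank-strict xs x∈ , rank-strict xs y∈

rank-injective : ∀ xs → x ∈ xs → y ∈ xs → rank xs x ≡ rank xs y → x ≡ y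
rank-injective {x} {y} xs x∈ y∈ rx≡ry with <-cmp x y
... | tri< x<y _ _ = contradiction rx≡ry (<⇒≢ (rank-strict xs x∈ x<y))
... | tri≈ _ x≡y _ = x≡y
... | tri> _ _ y<x = contradiction (sym rx≡ry) (<⇒≢ (rank-strict xs y∈ y<x))

UnseparatedMonotone-standardize : ∀ {g} → UnseparatedMonotone g (standardize xs) →
  UnseparatedMonotone (g ∘ rank xs) xs
UnseparatedMonotone-standardize {xs} mono w = SameOrder-trans
  (rank-SameOrder xs (Unseparated-∈ˡ w) (Unseparated-∈ʳ w))
  (mono (Unseparated-map (rank-mono xs) w))

Unique-standardize : Unique xs → Unique (standardize xs)
Unique-standardize {xs} = Unique-map⁺-local (rank-injective xs)

length-standardize : ∀ xs → length (standardize xs) ≡ length xs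
length-standardize xs = List.length-map (rank xs) xs

-- The bijection P

record Relabelling (xs ys : List ℕ) : Set where
  field
    relabel  : ℕ → ℕ
    image    : ys ≡ map relabel xs
    bounded  : ∀ {x} → x ∈ xs → relabel x ≤ length xs
    monotone : UnseparatedMonotone relabel xs

Relabelling-[] : Relabelling [] []
Relabelling-[] = record
  { relabel  = λ x → x
  ; image    = refl
  ; bounded  = λ ()
  ; monotone = λ w → contradiction w Unseparated-[]
  }

module RelabellingStep {a n b pa pb} (uniq : Unique (a ++ n ∷ b)) (≤n : All (_≤ n) (a ++ n ∷ b))
  (ra : Relabelling (standardize a) pa) (rb : Relabelling (standardize b) pb) where

  open Relabelling ra renaming (relabel to ga; image to pa≡; bounded to ga≤; monotone to ga-mono)
  open Relabelling rb renaming (relabel to gb; image to pb≡; bounded to gb≤; monotone to gb-mono)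

  N : ℕ
  N = length (a ++ n ∷ b)

  a+b<N : length a + length b < N
  a+b<N = subst (length a + length b <_) (sym (List.length-++ a))
                (+-monoʳ-< (length a) (n<1+n (length b)))

  h : ℕ → ℕ
  h x = if does (x ∈? a) then ga (rank a x) + length b
        else if does (x ≟ n) then N else gb (rank b x)

  n∉a : n ∉ a
  n∉a n∈a = Unique-++-disjoint a uniq n∈a (here refl)

  n∉b : n ∉ b
  n∉b = Unique.Unique[x∷xs]⇒x∉xs (Unique-++⁻ʳ a uniq)

  h-left : x ∈ a → h x ≡ ga (rank a x) + length b
  h-left {x} x∈a with x ∈? a
  ... | yes _   = refl
  ... | no x∉a = contradiction x∈a x∉a

  h-n : h n ≡ N
  h-n with n ∈? a | n ≡ᵇ n | proof (n ≟ n)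
  ... | yes n∈a | _ | _        = contradiction n∈a n∉a
  ... | no _    | _ | ofʸ _    = refl
  ... | no _    | _ | ofⁿ n≢n = contradiction refl n≢n

  h-right : x ∈ b → h x ≡ gb (rank b x)
  h-right {x} x∈b with x ∈? a | x ≡ᵇ n | proof (x ≟ n)
  ... | yes x∈a | _ | _        = contradiction (there x∈b) (Unique-++-disjoint a uniq x∈a)
  ... | no _    | _ | ofʸ refl = contradiction x∈b n∉b
  ... | no _    | _ | ofⁿ _    = refl

  h-left< : x ∈ a → h x < N
  h-left< {x} x∈a = begin-strict
    h x                               ≡⟨ h-left x∈a ⟩
    ga (rank a x) + length b          ≤⟨ +-monoˡ-≤ (length b) (ga≤ (∈-map⁺ (rank a) x∈a)) ⟩
    length (standardize a) + length b ≡⟨ cong (_+ length b) (length-standardize a) ⟩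
    length a + length b               <⟨ a+b<N ⟩
    N                                 ∎
    where open ≤-Reasoning

  h-right< : x ∈ b → h x < N
  h-right< {x} x∈b = begin-strict
    h x                    ≡⟨ h-right x∈b ⟩
    gb (rank b x)          ≤⟨ gb≤ (∈-map⁺ (rank b) x∈b) ⟩
    length (standardize b) ≡⟨ length-standardize b ⟩
    length b               ≤⟨ m≤n+m (length b) (length a) ⟩
    length a + length b    <⟨ a+b<N ⟩
    N                      ∎
    where open ≤-Reasoning

  h-bounded : x ∈ a ++ n ∷ b → h x ≤ N
  h-bounded x∈ with ∈-++⁻ a x∈
  ... | inj₁ x∈a         = <⇒≤ (h-left< x∈a)
  ... | inj₂ (here refl) = ≤-reflexive h-n
  ... | inj₂ (there x∈b) = <⇒≤ (h-right< x∈b)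

  image : map (_+ length b) pa ++ N ∷ pb ≡ map h (a ++ n ∷ b)
  image = begin
    map (_+ length b) pa ++ N ∷ pb
      ≡⟨ cong₂ (λ s t → map (_+ length b) s ++ N ∷ t) pa≡ pb≡ ⟩
    map (_+ length b) (map ga (standardize a)) ++ N ∷ map gb (standardize b)
      ≡⟨ cong₂ (λ s t → s ++ N ∷ t)
               (sym (trans (List.map-∘ a) (cong (map (_+ length b)) (List.map-∘ a))))
               (sym (List.map-∘ b)) ⟩
    map (λ x → ga (rank a x) + length b) a ++ N ∷ map (gb ∘ rank b) b
      ≡⟨ cong₂ _++_ (List.map-cong-local (All.tabulate (sym ∘ h-left)))
                    (cong₂ _∷_ (sym h-n) (List.map-cong-local (All.tabulate (sym ∘ h-right)))) ⟩
    map h a ++ h n ∷ map h b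
      ≡⟨ List.map-++ h a (n ∷ b) ⟨
    map h (a ++ n ∷ b) ∎
    where open ≡-Reasoning

  left<n : x ∈ a → x < n
  left<n x∈a = ≤∧≢⇒< (All.lookup (All.++⁻ˡ a ≤n) x∈a) λ { refl → n∉a x∈a }

  right<n : x ∈ b → x < n
  right<n x∈b = ≤∧≢⇒< (All.lookup (All.tail (All.++⁻ʳ a ≤n)) x∈b) λ { refl → n∉b x∈b }

  monotone : UnseparatedMonotone h (a ++ n ∷ b)
  monotone w with unseparatedAround w
  ... | within-left w′ = UnseparatedMonotone-cong h-left
    (λ w″ → SameOrder-trans (UnseparatedMonotone-standardize ga-mono w″) (SameOrder-+ʳ (length b)))
    w′
  ... | within-right w′ =
    UnseparatedMonotone-cong h-right (UnseparatedMonotone-standardize gb-mono) w′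
  ... | left-to-n x∈a refl = SameOrder-≤ (<⇒≤ (left<n x∈a)) (subst (h _ <_) (sym h-n) (h-left< x∈a))
  ... | n-to-right refl y∈b =
    SameOrder-sym (SameOrder-≤ (<⇒≤ (right<n y∈b)) (subst (h _ <_) (sym h-n) (h-right< y∈b)))
  ... | across-n x∈a y∈b n≤ = contradiction n≤ (<⇒≱ (⊔-lub (left<n x∈a) (right<n y∈b)))

  relabelling : Relabelling (a ++ n ∷ b) (map (_+ length b) pa ++ [ N ] ++ pb)
  relabelling = record { relabel = h ; image = image ; bounded = h-bounded ; monotone = monotone }

P'-relabelling : ∀ k xs → length xs ≤ k → Unique xs → Relabelling xs (P' k xs)
P'-relabelling zero    []       _    _    = Relabelling-[]
P'-relabelling (suc k) []       _    _    = Relabelling-[]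
P'-relabelling (suc k) (z ∷ zs) len≤ uniq = subst
  (λ l → Relabelling l
           (map (_+ length b) (P' k (standardize a)) ++ [ length l ] ++ P' k (standardize b)))
  (sym split)
  (RelabellingStep.relabelling uniq′ bounded
    (recurse a (length-a≤ len≤) (Unique-++⁻ˡ a uniq′))
    (recurse b (length-b≤ len≤) (Unique.drop⁺ 1 (Unique-++⁻ʳ a uniq′))))
  where
  open MaxSplit z zs
  uniq′ : Unique (a ++ n ∷ b)
  uniq′ = subst Unique split uniq
  recurse : ∀ l → length l ≤ k → Unique l → Relabelling (standardize l) (P' k (standardize l))
  recurse l l≤k uniq-l = P'-relabelling k (standardize l)
    (subst (_≤ k) (sym (length-standardize l)) l≤k) (Unique-standardize uniq-l)

P-relabelling : Unique xs → Relabelling xs (P xs)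
P-relabelling {xs} = P'-relabelling (length xs) xs ≤-refl

at-map-posOf : ∀ (f : ℕ → ℕ) xs → x ∈ xs → at (map f xs) (posOf x xs) ≡ f x
at-map-posOf {x} f (z ∷ xs) x∈ with x ≡ᵇ z | proof (x ≟ z)
... | _ | ofʸ refl = refl
... | _ | ofⁿ x≢z with x∈
...   | here x≡z  = contradiction x≡z x≢z
...   | there x∈xs = at-map-posOf f xs x∈xs

lam-relabel : (r : Relabelling π (P π)) → x ∈ π → lam π x ≡ Relabelling.relabel r x
lam-relabel {π} {x} r x∈ =
  trans (cong (λ l → at l (posOf x π)) (Relabelling.image r))
        (at-map-posOf (Relabelling.relabel r) π x∈)

lam-unseparatedMonotone : Unique π → UnseparatedMonotone (lam π) π
lam-unseparatedMonotone {π} uniq = UnseparatedMonotone-cong (lam-relabel r) (Relabelling.monotone r)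
  where
  r : Relabelling π (P π)
  r = P-relabelling uniq

-- Statistics

UnseparatedMonotone-∷⁻ : ∀ {f z} → UnseparatedMonotone f (z ∷ θ) → UnseparatedMonotone f θ
UnseparatedMonotone-∷⁻ {z = z} mono w = mono (Unseparated-++ˡ [ z ] w)

UnseparatedMonotone-++⁻ˡ : ∀ {f} r → UnseparatedMonotone f (θ ++ r) → UnseparatedMonotone f θ
UnseparatedMonotone-++⁻ˡ r mono w = mono (Unseparated-++ʳ r w)

UnseparatedMonotone-reverse : ∀ {f} → UnseparatedMonotone f θ → UnseparatedMonotone f (reverse θ)
UnseparatedMonotone-reverse {θ} mono w =
  SameOrder-sym
    (mono (subst (λ l → Unseparated l _ _) (List.reverse-involutive θ) (Unseparated-reverse w)))

UnseparatedMonotone-drop : ∀ {f z r} → z ≤ x →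
  UnseparatedMonotone f (x ∷ z ∷ r) → UnseparatedMonotone f (x ∷ r)
UnseparatedMonotone-drop z≤x mono w = mono (Unseparated-insert z≤x w)

<ᵇ-map : ∀ f → SameOrder x y (f x) (f y) → (x <ᵇ y) ≡ (f x <ᵇ f y)
<ᵇ-map f same = <ᵇ-cong (SameOrder⇒⇔ f same)

upDown-map : ∀ f θ → UnseparatedMonotone f θ → upDown θ ≡ upDown (map f θ)
upDown-map f []          _    = refl
upDown-map f (x ∷ [])    _    = refl
upDown-map f (x ∷ y ∷ r) mono = cong₂ _∷_
  (cong (λ c → if c then u else d) (<ᵇ-map f (mono (unseparated [] [] r refl []))))
  (upDown-map f (y ∷ r) (UnseparatedMonotone-∷⁻ mono))

allB-<ᵇ-map : ∀ f x r → UnseparatedMonotone f (x ∷ r) → allB (_<ᵇ x) r ≡ allB (_<ᵇ f x) (map f r)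
allB-<ᵇ-map f x []      mono = refl
allB-<ᵇ-map f x (z ∷ r) mono
  with z <ᵇ x | <ᵇ-reflects-< z x | <ᵇ-map f (SameOrder-sym (mono (unseparated [] [] r refl [])))
... | true  | ofʸ z<x | z<ᵇx≡ rewrite sym z<ᵇx≡ =
  allB-<ᵇ-map f x r (UnseparatedMonotone-drop (<⇒≤ z<x) mono)
... | false | _       | z<ᵇx≡ rewrite sym z<ᵇx≡ = refl

isRLMax-map : ∀ f θ i → UnseparatedMonotone f θ → isRLMax θ i ≡ isRLMax (map f θ) i
isRLMax-map f []      i             _    = refl
-- Position 0 does not exist (positions are 1-based); there both sides are false.
isRLMax-map f (x ∷ r) zero          _    rewrite <ᵇ-irrefl x | <ᵇ-irrefl (f x) = refl
isRLMax-map f (x ∷ r) (suc zero)    mono = allB-<ᵇ-map f x r mono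
isRLMax-map f (x ∷ r) (suc (suc j)) mono = isRLMax-map f r (suc j) (UnseparatedMonotone-∷⁻ mono)

allB-∷ʳ : ∀ p (l : List ℕ) z → allB p (l ++ [ z ]) ≡ (if p z then allB p l else false)
allB-∷ʳ p []      z = refl
allB-∷ʳ p (w ∷ l) z with p w
... | true  = allB-∷ʳ p l z
... | false with p z
...   | true  = refl
...   | false = refl

allB-reverse : ∀ p (l : List ℕ) → allB p (reverse l) ≡ allB p l
allB-reverse p []      = refl
allB-reverse p (w ∷ l) = begin
  allB p (reverse (w ∷ l))            ≡⟨ cong (allB p) (List.unfold-reverse w l) ⟩
  allB p (reverse l ++ [ w ])         ≡⟨ allB-∷ʳ p (reverse l) w ⟩
  (if p w then allB p (reverse l) else false) ≡⟨ cong (if p w then_else false) (allB-reverse p l) ⟩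
  allB p (w ∷ l)                      ∎
  where open ≡-Reasoning

allB-<ᵇ-map-prefix : ∀ f x pre → UnseparatedMonotone f (pre ++ [ x ]) →
  allB (_<ᵇ x) pre ≡ allB (_<ᵇ f x) (map f pre)
allB-<ᵇ-map-prefix f x pre mono = begin
  allB (_<ᵇ x) pre                     ≡⟨ allB-reverse _ pre ⟨
  allB (_<ᵇ x) (reverse pre)           ≡⟨ allB-<ᵇ-map f x (reverse pre) mono′ ⟩
  allB (_<ᵇ f x) (map f (reverse pre)) ≡⟨ cong (allB _) (List.reverse-map f pre) ⟩
  allB (_<ᵇ f x) (reverse (map f pre)) ≡⟨ allB-reverse _ (map f pre) ⟩
  allB (_<ᵇ f x) (map f pre)           ∎
  where
  open ≡-Reasoning
  mono′ : UnseparatedMonotone f (x ∷ reverse pre)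
  mono′ = subst (UnseparatedMonotone f) (List.reverse-++ pre [ x ])
                (UnseparatedMonotone-reverse mono)

take-at-drop : ∀ (θ : List ℕ) j → j < length θ → θ ≡ take j θ ++ at θ j ∷ drop (suc j) θ
take-at-drop (x ∷ θ) zero    _         = refl
take-at-drop (x ∷ θ) (suc j) (s≤s j<) = cong (x ∷_) (take-at-drop θ j j<)

at-map : ∀ (f : ℕ → ℕ) θ j → j < length θ → at (map f θ) j ≡ f (at θ j)
at-map f (x ∷ θ) zero    _         = refl
at-map f (x ∷ θ) (suc j) (s≤s j<) = at-map f θ j j<

at-out-of-range : ∀ (θ : List ℕ) j → length θ ≤ j → at θ j ≡ 0
at-out-of-range []      j       _        = refl
at-out-of-range (x ∷ θ) (suc j) (s≤s j≥) = at-out-of-range θ j j≥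

allB-<ᵇ0-map : ∀ f (θ : List ℕ) → allB (_<ᵇ 0) θ ≡ allB (_<ᵇ 0) (map f θ)
allB-<ᵇ0-map f []      = refl
allB-<ᵇ0-map f (x ∷ θ) = refl

isLRMax-below : ∀ f θ j → j < length θ → UnseparatedMonotone f θ →
  isLRMax θ (suc j) ≡ isLRMax (map f θ) (suc j)
isLRMax-below f θ j j< mono = begin
  allB (_<ᵇ at θ j) (take j θ)
    ≡⟨ allB-<ᵇ-map-prefix f (at θ j) (take j θ) mono-prefix ⟩
  allB (_<ᵇ f (at θ j)) (map f (take j θ))
    ≡⟨ cong₂ (λ v l → allB (_<ᵇ v) l) (at-map f θ j j<) (List.take-map j θ) ⟨
  allB (_<ᵇ at (map f θ) j) (take j (map f θ)) ∎
  where
  open ≡-Reasoning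
  θ≡ : θ ≡ (take j θ ++ [ at θ j ]) ++ drop (suc j) θ
  θ≡ = trans (take-at-drop θ j j<) (sym (List.++-assoc (take j θ) [ at θ j ] _))
  mono-prefix : UnseparatedMonotone f (take j θ ++ [ at θ j ])
  mono-prefix = UnseparatedMonotone-++⁻ˡ (drop (suc j) θ) (subst (UnseparatedMonotone f) θ≡ mono)

isLRMax-beyond : ∀ θ j → length θ ≤ j → isLRMax θ (suc j) ≡ allB (_<ᵇ 0) θ
isLRMax-beyond θ j j≥ =
  cong₂ (λ v l → allB (_<ᵇ v) l) (at-out-of-range θ j j≥) (List.take-all j θ j≥)

isLRMax-map : ∀ f θ i → UnseparatedMonotone f θ → isLRMax θ i ≡ isLRMax (map f θ) i
isLRMax-map f θ zero    _    = refl
isLRMax-map f θ (suc j) mono with j <? length θ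
... | yes j< = isLRMax-below f θ j j< mono
... | no j≮ = begin
  isLRMax θ (suc j)         ≡⟨ isLRMax-beyond θ j j≥ ⟩
  allB (_<ᵇ 0) θ            ≡⟨ allB-<ᵇ0-map f θ ⟩
  allB (_<ᵇ 0) (map f θ)    ≡⟨ isLRMax-beyond (map f θ) j (subst (_≤ j) (sym (List.length-map f θ)) j≥)
                             ⟨
  isLRMax (map f θ) (suc j) ∎
  where
  open ≡-Reasoning
  j≥ : length θ ≤ j
  j≥ = ≮⇒≥ j≮

filter-positions-map : ∀ f (stat : List ℕ → ℕ → Bool) → (∀ i → stat θ i ≡ stat (map f θ) i) →
  filter (λ i → stat θ i Bool.≟ true) (positions θ)
    ≡ filter (λ i → stat (map f θ) i Bool.≟ true) (positions (map f θ))
filter-positions-map {θ} f stat stat≡ = begin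
  filter (λ i → stat θ i Bool.≟ true) (positions θ)
    ≡⟨ List.filter-≐ _ _ ((λ {i} → trans (sym (stat≡ i))) , (λ {i} → trans (stat≡ i)))
                     (positions θ) ⟩
  filter (λ i → stat (map f θ) i Bool.≟ true) (positions θ)
    ≡⟨ cong (λ n → filter (λ i → stat (map f θ) i Bool.≟ true) (map suc (upTo n)))
            (List.length-map f θ) ⟨
  filter (λ i → stat (map f θ) i Bool.≟ true) (positions (map f θ)) ∎
  where open ≡-Reasoning

Unique-applyOps : ∀ A → IsPerm θ → Unique (applyOps A θ)
Unique-applyOps {θ} A θ-perm =
  Unique-↭ (↭-sym (applyOps-↭ A θ)) (Unique-↭ (↭-sym θ-perm) (Unique-idPerm (length θ)))

corollary4p11 : (A : List Op) (θ : List ℕ) → IsPerm θ → SortedBy A θ →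
    (length (rlMaxPositions θ) ≡ length (rlMaxPositions (Φ A θ)))
    × (rlMaxPositions θ ≡ rlMaxPositions (Φ A θ))
    × (length (lrMaxPositions θ) ≡ length (lrMaxPositions (Φ A θ)))
    × (lrMaxPositions θ ≡ lrMaxPositions (Φ A θ))
    × (upDown θ ≡ upDown (Φ A θ))
    × ((B : Set) (f : List UD → B) → f (upDown θ) ≡ f (upDown (Φ A θ)))
corollary4p11 A θ θ-perm _ = cong length rl , rl , cong length lr , lr , ud , λ _ g → cong g ud
  where
  λπ : ℕ → ℕ
  λπ = lam (applyOps A θ)
  mono : UnseparatedMonotone λπ θ
  mono = UnseparatedMonotone-transfer (lam-unseparatedMonotone (Unique-applyOps A θ-perm))
    (applyOps-unseparated A ∘ inj₁)
  rl : rlMaxPositions θ ≡ rlMaxPositions (Φ A θ)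
  rl = filter-positions-map λπ isRLMax (λ i → isRLMax-map λπ θ i mono)
  lr : lrMaxPositions θ ≡ lrMaxPositions (Φ A θ)
  lr = filter-positions-map λπ isLRMax (λ i → isLRMax-map λπ θ i mono)
  ud : upDown θ ≡ upDown (Φ A θ)
  ud = upDown-map λπ θ mono
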